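{- For any graph $G$ and vertex set $S\subseteq V(G)$, there are at most $2^{\mathcal{O}(|S|\log|S|)}$ different $S$-connecting systems in $G$.
   Context: An $S$-connecting system in $G$ is a pair $(\mathcal{S},\mathcal{T})$ where $\mathcal{S}=\{S_1,\dots,S_m\}$ is a collection of subsets of $S$ and $\mathcal{T}$ is a tree such that: (1) $V(\mathcal{T})=S\cup\{u_1,\dots,u_m\}$ with $m=|\mathcal{S}|$; (2) for all $i\in[m]$, $S_i=N_{\mathcal{T}}(u_i)\subseteq S$ and $\deg_{\mathcal{T}}(u_i)>1$; (3) for all distinct $s,s'\in S$, if $\{s,s'\}\in E(\mathcal{T})$ then $\{s,s'\}\in E(G)$. Systems are counted as labeled trees $\mathcal{T}$ on vertex set $S\cup\{u_1,\dots,u_m\}$ (the collection $\mathcal{S}$ being determined by $\mathcal{T}$). -}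

module Defs where

open import Data.Nat using (ℕ; _+_; _≤_)
open import Data.Fin using (Fin; _↑ˡ_; _↑ʳ_)
open import Data.Fin.Subset using (Subset; _∈_)
open import Data.Vec using (Vec; lookup)
open import Data.Bool using (Bool; true)
open import Data.List using (List; length; take; _++_)
open import Data.List.Relation.Unary.Linked using (Linked)
open import Data.List.Relation.Unary.Unique.Propositional using (Unique)
open import Data.Product using (Σ; _×_; ∃-syntax; proj₁; proj₂)
open import Data.Sum using (_⊎_)
open import Data.Empty using (⊥)
open import Data.Unit using (⊤)
open import Relation.Nullary using (¬_)
open import Relation.Binary.PropositionalEquality using (_≡_)
open import Relation.Binary.Construct.Closure.ReflexiveTransitive using (Star)

record SimpleGraph (n : ℕ) : Set₁ where
  field
    Edge   : Fin n → Fin n → Set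
    sym    : ∀ {x y} → Edge x y → Edge y x
    irrefl : ∀ {x} → ¬ Edge x x
open SimpleGraph public

-- Adjacency matrix (as nested vectors, so that equality is first-order).
Matrix : ℕ → Set
Matrix k = Vec (Vec Bool k) k

Adj : ∀ {k} → Matrix k → Fin k → Fin k → Set
Adj A i j = lookup (lookup A i) j ≡ true

IsCycle : ∀ {k} → Matrix k → List (Fin k) → Set
IsCycle A xs = (3 ≤ length xs) × Unique xs × Linked (Adj A) (xs ++ take 1 xs)

IsTreeOn : ∀ {k} → (Fin k → Set) → Matrix k → Set
IsTreeOn {k} InV A =
    (∀ i j → Adj A i j → Adj A j i)
  × (∀ i → ¬ Adj A i i)
  × (∀ i j → Adj A i j → InV i)
  × (∀ i j → InV i → InV j → Star (Adj A) i j)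
  × (∀ xs → ¬ IsCycle A xs)

-- Tree vertices for a system with m auxiliary vertices u_1..u_m:
-- the vertex v of G is encoded as (v ↑ˡ m), the vertex u_i as (n ↑ʳ i).
-- Vertex set of the tree is S ∪ {u_1, …, u_m}.
InTree : ∀ {n} (S : Subset n) (m : ℕ) → Fin (n + m) → Set
InTree {n} S m x =
  (Σ (Fin n) λ v → (x ≡ v ↑ˡ m) × (v ∈ S)) ⊎ (Σ (Fin m) λ i → x ≡ n ↑ʳ i)

IsConnectingSystem : ∀ {n} → SimpleGraph n → Subset n → (m : ℕ) → Matrix (n + m) → Set
IsConnectingSystem {n} G S m A =
    IsTreeOn (InTree S m) A
    -- (2) N(u_i) ⊆ S: no edge between two auxiliary vertices
  × (∀ i j → ¬ Adj A (n ↑ʳ i) (n ↑ʳ j))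
  × (∀ i → Σ (Fin n) λ s → Σ (Fin n) λ s' →
        ¬ (s ≡ s') × Adj A (n ↑ʳ i) (s ↑ˡ m) × Adj A (n ↑ʳ i) (s' ↑ˡ m))
  × (∀ s s' → Adj A (s ↑ˡ m) (s' ↑ˡ m) → Edge G s s')

LabeledTree : ℕ → Set
LabeledTree n = Σ ℕ λ m → Matrix (n + m)

ConnectingSystem : ∀ {n} → SimpleGraph n → Subset n → Set
ConnectingSystem G S =
  Σ (LabeledTree _) λ T → IsConnectingSystem G S (proj₁ T) (proj₂ T)

{-# OPTIONS --safe #-}
-- Peeling off leaves one at a time shows that every finite forest has a parent map p, i.e. its
-- edges are exactly the pairs {x, p x}. In an S-connecting system every auxiliary vertex u_i has
-- at least two neighbours, so at least one of them is a child of u_i; that child lies in S, and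
-- distinct u_i have distinct children, hence m ≤ |S|. Numbering the tree vertices by
-- Fin (|S| + m), the tree is determined by m and by its parent map, a function from at most
-- 2|S| numbers to at most 2|S| + 1 values. This leaves at most
-- (|S| + 1) · (2|S| + 1)^(2|S|) = 2^O(|S| log |S|) possible trees.
module Submission where

open import Defs
open import Data.Bool using (Bool; true; false)
open import Data.Bool.Properties using () renaming (_≟_ to _≟ᵇ_)
open import Data.Fin as Fin using (Fin; zero; suc; _≟_; punchIn; punchOut; _↑ˡ_; _↑ʳ_; splitAt; join;
  fromℕ<; inject≤; combine; funToFin; finToFun)
open import Data.Fin.Properties using (any?; injective⇒≤; punchIn-injective; punchInᵢ≢i; punchIn-punchOut;
  punchOut-punchIn; punchOut-cong; ↑ˡ-injective; ↑ʳ-injective; splitAt-↑ˡ; splitAt-↑ʳ; splitAt⁻¹-↑ˡ;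
  splitAt⁻¹-↑ʳ; fromℕ<-injective; inject≤-injective; combine-injective; finToFun-funToFin)
  renaming (suc-injective to Fin-suc-injective)
open import Data.Fin.Subset using (Subset; inside; outside; _∈_; ∣_∣)
open import Data.List using (List; []; _∷_; [_]; length; take; _++_; map)
open import Data.List.Properties using (length-map; map-++; take-map)
open import Data.List.Membership.Propositional using () renaming (_∈_ to _∈ₗ_; _∉_ to _∉ₗ_)
open import Data.List.Membership.Propositional.Properties using (∈-lookup)
import Data.List.Membership.DecPropositional as DecMembership
open import Data.List.Relation.Unary.All as All using (All)
open import Data.List.Relation.Unary.All.Properties using (¬Any⇒All¬)
open import Data.List.Relation.Unary.Any using (here; there; index)
open import Data.List.Relation.Unary.Linked using (Linked; [-]; _∷_)
import Data.List.Relation.Unary.Linked.Properties as Linked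
open import Data.List.Relation.Unary.Unique.Propositional using (Unique; []; _∷_)
import Data.List.Relation.Unary.Unique.Propositional.Properties as Unique
open import Data.Maybe as Maybe using (Maybe; just; nothing; maybe; _>>=_)
open import Data.Maybe.Properties using (just-injective; map-injective)
import Data.Maybe.Relation.Unary.All as MaybeAll
open import Data.Nat using (ℕ; zero; suc; _+_; _*_; _^_; _∸_; _≤_; _<_; z≤n; s≤s; ⌈_/2⌉; ⌊_/2⌋)
open import Data.Nat.Induction using (<-rec)
open import Data.Nat.Logarithm using (⌈log₂_⌉; ⌈log₂⌉-mono-≤; ⌈log₂⌈n/2⌉⌉≡⌈log₂n⌉∸1)
open import Data.Nat.Properties using (≤-refl; ≤-reflexive; ≤-trans; module ≤-Reasoning; n≤1+n; 1+n≰n;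
  m≤m+n; +-suc; +-identityʳ; *-assoc; +-monoˡ-≤; +-monoʳ-≤; +-mono-≤; *-monoˡ-≤; *-monoʳ-≤; ^-monoˡ-≤;
  ^-monoʳ-≤; ^-*-assoc; m+[n∸m]≡n; ⌊n/2⌋+⌈n/2⌉≡n; ⌊n/2⌋≤⌈n/2⌉; ⌈n/2⌉<n)
open import Data.Nat.Tactic.RingSolver using (solve-∀)
open import Data.Product using (Σ; _×_; _,_; proj₁; proj₂; ∃; ∃₂; ∃-syntax)
open import Data.Sum using (_⊎_; inj₁; inj₂; [_,_]′; map₁; swap)
open import Data.Sum.Function.Propositional using (_⊎-⇔_)
open import Data.Vec using (Vec; _∷_; lookup; here; there)
open import Data.Vec.Properties using (tabulate∘lookup; tabulate-cong)
open import Function using (_∘_; _on_; Injective; _⇔_; mk⇔; Equivalence)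
import Function.Properties.Equivalence as ⇔
open import Level using (0ℓ)
open import Relation.Binary using (Rel; Decidable; Symmetric)
open import Relation.Binary.PropositionalEquality as ≡
  using (_≡_; _≢_; _≗_; refl; cong; subst; module ≡-Reasoning)
open import Relation.Nullary using (¬_; yes; no; contradiction)
open import Relation.Nullary.Decidable using (_×-dec_; ¬?)

Cycle : ∀ {A : Set} → Rel A 0ℓ → List A → Set
Cycle R xs = 3 ≤ length xs × Unique xs × Linked R (xs ++ take 1 xs)

record IsForest {K : ℕ} (R : Rel (Fin K) 0ℓ) : Set where
  field
    decidable   : Decidable R
    symmetric   : Symmetric R
    irreflexive : ∀ {i} → ¬ R i i
    acyclic     : ∀ xs → ¬ Cycle R xs

Unique-lookup-injective : ∀ {A : Set} {xs : List A} → Unique xs → Injective _≡_ _≡_ (Data.List.lookup xs)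
Unique-lookup-injective (_  ∷ _) {zero}  {zero}  _  = refl
Unique-lookup-injective (x∉ ∷ _) {zero}  {suc j} eq = contradiction eq (All.lookup x∉ (∈-lookup j))
Unique-lookup-injective (x∉ ∷ _) {suc i} {zero}  eq = contradiction (≡.sym eq) (All.lookup x∉ (∈-lookup i))
Unique-lookup-injective (_  ∷ u) {suc i} {suc j} eq = cong suc (Unique-lookup-injective u eq)

Unique⇒length≤ : ∀ {K} {xs : List (Fin K)} → Unique xs → length xs ≤ K
Unique⇒length≤ u = injective⇒≤ (Unique-lookup-injective u)

Linked-take-∈ : ∀ {A : Set} {R : Rel A 0ℓ} {xs b z} → Linked R xs → (b∈xs : b ∈ₗ xs) → R b z →
                Linked R (take (suc (Fin.toℕ (index b∈xs))) xs ++ [ z ])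
Linked-take-∈ _           (here refl)  Rbz = Rbz ∷ [-]
Linked-take-∈ (Rxy ∷ Rxs) (there b∈xs) Rbz = Rxy ∷ Linked-take-∈ Rxs b∈xs Rbz

isForest-on : ∀ {K K′} {R : Rel (Fin K) 0ℓ} {f : Fin K′ → Fin K} →
              Injective _≡_ _≡_ f → IsForest R → IsForest (R on f)
isForest-on {R = R} {f} f-inj F = record
  { decidable   = λ i j → decidable (f i) (f j)
  ; symmetric   = symmetric
  ; irreflexive = irreflexive
  ; acyclic     = λ xs (3≤∣xs∣ , u , l) → acyclic (map f xs)
      ( subst (3 ≤_) (≡.sym (length-map f xs)) 3≤∣xs∣
      , Unique.map⁺ f-inj u
      , subst (Linked R) (map-cycle xs) (Linked.map⁺ l))
  }
  where
  open IsForest F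
  map-cycle : ∀ xs → map f (xs ++ take 1 xs) ≡ map f xs ++ take 1 (map f xs)
  map-cycle xs = ≡.trans (map-++ f xs (take 1 xs)) (cong (map f xs ++_) (≡.sym (take-map 1 xs)))

-- Isolated vertices are leaves too, with a = nothing.
Leaf : ∀ {K} → Rel (Fin K) 0ℓ → Fin K → Maybe (Fin K) → Set
Leaf R v a = ∀ b → R v b ⇔ a ≡ just b

module LeafSearch {K} {R : Rel (Fin K) 0ℓ} (F : IsForest R) where
  open IsForest F
  open DecMembership (_≟_ {K}) using (_∈?_)

  -- Otherwise x, y, …, b and the edge b x would form a cycle.
  no-chord : ∀ {x y ys b} → Unique (x ∷ y ∷ ys) → Linked R (x ∷ y ∷ ys) → R x b → b ∉ₗ ys
  no-chord {x} {y} {w ∷ ws} u l Rxb b∈ys =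
    acyclic (x ∷ y ∷ take (suc (Fin.toℕ (index b∈ys))) (w ∷ ws))
      ( s≤s (s≤s (s≤s z≤n))
      , Unique.take⁺ (3 + Fin.toℕ (index b∈ys)) u
      , Linked-take-∈ l (there (there b∈ys)) (symmetric Rxb))

  maximal-path-end : ∀ {x xs} → Unique (x ∷ xs) → Linked R (x ∷ xs) →
                     (∀ {b} → R x b → b ∈ₗ x ∷ xs) → ∃ (Leaf R x)
  maximal-path-end {x} {[]} _ _ closed = nothing , λ b → mk⇔ (isolated b) λ ()
    where
    isolated : ∀ b → R x b → nothing ≡ just b
    isolated b Rxb with closed Rxb
    ... | here refl = contradiction Rxb irreflexive
  maximal-path-end {x} {y ∷ ys} u l@(Rxy ∷ _) closed = just y , λ b → mk⇔ (only-y b) λ { refl → Rxy }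
    where
    only-y : ∀ b → R x b → just y ≡ just b
    only-y b Rxb with closed Rxb
    ... | here refl          = contradiction Rxb irreflexive
    ... | there (here refl)  = refl
    ... | there (there b∈ys) = contradiction b∈ys (no-chord u l Rxb)

  -- A path has at most K vertices, so `fuel` bounds how often it can still be extended.
  grow-path : ∀ fuel {x xs} → K ≤ length (x ∷ xs) + fuel → Unique (x ∷ xs) → Linked R (x ∷ xs) →
              ∃₂ (Leaf R)
  grow-path fuel {x} {xs} bound u l with any? (λ b → decidable x b ×-dec ¬? (b ∈? x ∷ xs))
  ... | no ¬new = x , maximal-path-end u l closed
    where
    closed : ∀ {b} → R x b → b ∈ₗ x ∷ xs
    closed {b} Rxb with b ∈? x ∷ xs
    ... | yes b∈ = b∈
    ... | no b∉  = contradiction (b , Rxb , b∉) ¬new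
  ... | yes (b , Rxb , b∉) with fuel | ¬Any⇒All¬ (x ∷ xs) b∉ ∷ u
  ...   | zero     | u′ =
    contradiction (≤-trans (Unique⇒length≤ u′) (≤-trans bound (≤-reflexive (+-identityʳ _)))) 1+n≰n
  ...   | suc fuel | u′ =
    grow-path fuel (≤-trans bound (≤-reflexive (+-suc _ fuel))) u′ (symmetric Rxb ∷ l)

  findLeaf : Fin K → ∃₂ (Leaf R)
  findLeaf v = grow-path K {v} (n≤1+n K) (All.[] ∷ []) [-]

IsParentMap : ∀ {K} → Rel (Fin K) 0ℓ → (Fin K → Maybe (Fin K)) → Set
IsParentMap R p = ∀ i j → R i j ⇔ (p i ≡ just j ⊎ p j ≡ just i)

data PunchInView {K} (v : Fin (suc K)) : Fin (suc K) → Set where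
  pivot   : PunchInView v v
  punched : ∀ b → PunchInView v (punchIn v b)

punchInView : ∀ {K} (v b : Fin (suc K)) → PunchInView v b
punchInView v b with v ≟ b
... | yes refl = pivot
... | no v≢b   = subst (PunchInView v) (punchIn-punchOut v≢b) (punched _)

map-just-⇔ : ∀ {A B : Set} {f : A → B} → Injective _≡_ _≡_ f →
             ∀ {x y} → (x ≡ just y) ⇔ (Maybe.map f x ≡ just (f y))
map-just-⇔ f-inj = mk⇔ (cong (Maybe.map _)) (map-injective f-inj)

module AttachLeaf {K} {R : Rel (Fin (suc K)) 0ℓ} (F : IsForest R) {v a} (v-leaf : Leaf R v a)
                  {p} (p-parent : IsParentMap (R on punchIn v) p) where
  open IsForest F

  parent : Fin (suc K) → Maybe (Fin (suc K))
  parent b with v ≟ b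
  ... | yes _  = a
  ... | no v≢b = Maybe.map (punchIn v) (p (punchOut v≢b))

  parent-pivot : parent v ≡ a
  parent-pivot with v ≟ v
  ... | yes _  = refl
  ... | no v≢v = contradiction refl v≢v

  parent-punchIn : ∀ b → parent (punchIn v b) ≡ Maybe.map (punchIn v) (p b)
  parent-punchIn b with v ≟ punchIn v b
  ... | yes v≡b = contradiction (≡.sym v≡b) (punchInᵢ≢i v b)
  ... | no _    = cong (Maybe.map (punchIn v) ∘ p) (≡.trans (punchOut-cong v refl) (punchOut-punchIn v))

  parent≢just-pivot : ∀ b → parent b ≢ just v
  parent≢just-pivot b with v ≟ b
  ... | yes _  = irreflexive ∘ Equivalence.from (v-leaf v)
  ... | no v≢b with p (punchOut v≢b)
  ...   | nothing = λ ()
  ...   | just c  = punchInᵢ≢i v c ∘ just-injective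

  pivot-⇔ : ∀ j → R v j ⇔ (parent v ≡ just j ⊎ parent j ≡ just v)
  pivot-⇔ j rewrite parent-pivot = mk⇔ (inj₁ ∘ Equivalence.to (v-leaf j))
    [ Equivalence.from (v-leaf j) , (λ e → contradiction e (parent≢just-pivot j)) ]′

  punched-⇔ : ∀ i j → R (punchIn v i) (punchIn v j) ⇔
              (parent (punchIn v i) ≡ just (punchIn v j) ⊎ parent (punchIn v j) ≡ just (punchIn v i))
  punched-⇔ i j rewrite parent-punchIn i | parent-punchIn j =
    ⇔.trans (p-parent i j) (map-just-⇔ punchIn-inj ⊎-⇔ map-just-⇔ punchIn-inj)
    where
    punchIn-inj : Injective _≡_ _≡_ (punchIn v)
    punchIn-inj = punchIn-injective v _ _

  isParentMap : IsParentMap R parent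
  isParentMap i j with punchInView v i | punchInView v j
  ... | pivot      | _          = pivot-⇔ j
  ... | punched i′ | pivot      =
    ⇔.trans (mk⇔ symmetric symmetric) (⇔.trans (pivot-⇔ (punchIn v i′)) (mk⇔ swap swap))
  ... | punched i′ | punched j′ = punched-⇔ i′ j′

parentMap : ∀ {K} {R : Rel (Fin K) 0ℓ} → IsForest R → ∃ (IsParentMap R)
parentMap {zero}  F = (λ ()) , λ ()
parentMap {suc K} F =
  let v , a , v-leaf = LeafSearch.findLeaf F zero
      p , p-parent   = parentMap (isForest-on (punchIn-injective v _ _) F)
  in AttachLeaf.parent F v-leaf p-parent , AttachLeaf.isParentMap F v-leaf p-parent

two-neighbours⇒child : ∀ {K} {R : Rel (Fin K) 0ℓ} {p v a b} → IsParentMap R p →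
                       R v a → R v b → a ≢ b → p a ≡ just v ⊎ p b ≡ just v
two-neighbours⇒child p-parent Rva Rvb a≢b
  with Equivalence.to (p-parent _ _) Rva | Equivalence.to (p-parent _ _) Rvb
... | inj₂ pa≡v | _         = inj₁ pa≡v
... | inj₁ _    | inj₂ pb≡v = inj₂ pb≡v
... | inj₁ pv≡a | inj₁ pv≡b = contradiction (just-injective (≡.trans (≡.sym pv≡a) pv≡b)) a≢b

same-parentMap⇒⇔ : ∀ {K} {R R′ : Rel (Fin K) 0ℓ} {p q} → IsParentMap R p → IsParentMap R′ q →
                   p ≗ q → ∀ i j → R i j ⇔ R′ i j
same-parentMap⇒⇔ p-parent q-parent p≗q i j with p-parent i j
... | R⇔p rewrite p≗q i | p≗q j = ⇔.trans R⇔p (⇔.sym (q-parent i j))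

maybe-suc-zero-injective : ∀ {L} → Injective _≡_ _≡_ (maybe {B = λ _ → Fin (suc L)} suc zero)
maybe-suc-zero-injective {x = nothing} {nothing} _  = refl
maybe-suc-zero-injective {x = just i}  {just j}  eq = cong just (Fin-suc-injective eq)

module ParentMapCode {X : Set} {L : ℕ} (number : X → Maybe (Fin L)) (vertexAt : Fin L → X)
                     (vertexAt-number : ∀ {x k} → number x ≡ just k → vertexAt k ≡ x) where

  Numbered : X → Set
  Numbered x = number x ≢ nothing

  Supported : (X → Maybe X) → Set
  Supported p = ∀ {x y} → p x ≡ just y → Numbered x × Numbered y

  encode : (X → Maybe X) → Fin (suc L ^ L)
  encode p = funToFin (λ k → maybe suc zero (p (vertexAt k) >>= number))

  Supported⇒numbered : ∀ {r} → Supported r → ∀ x → MaybeAll.All Numbered (r x)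
  Supported⇒numbered {r} r-supp x with r x in x↦y
  ... | nothing = MaybeAll.nothing
  ... | just y  = MaybeAll.just (proj₂ (r-supp x↦y))

  Supported⇒unnumbered : ∀ {r x} → Supported r → number x ≡ nothing → r x ≡ nothing
  Supported⇒unnumbered {r} {x} r-supp x↦nothing with r x in x↦y
  ... | nothing = refl
  ... | just y  = contradiction x↦nothing (proj₁ (r-supp x↦y))

  map-vertexAt-number : ∀ {a} → MaybeAll.All Numbered a → Maybe.map vertexAt (a >>= number) ≡ a
  map-vertexAt-number MaybeAll.nothing = refl
  map-vertexAt-number (MaybeAll.just {y} y-numbered) with number y in eq
  ... | just k  = cong just (vertexAt-number eq)
  ... | nothing = contradiction refl y-numbered

  encode-injective : ∀ {p q} → Supported p → Supported q → encode p ≡ encode q → p ≗ q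
  encode-injective {p} {q} p-supp q-supp eq x with number x in x↦k
  ... | nothing = ≡.trans (Supported⇒unnumbered p-supp x↦k) (≡.sym (Supported⇒unnumbered q-supp x↦k))
  ... | just k  = subst (λ y → p y ≡ q y) (vertexAt-number x↦k) (begin
    p (vertexAt k)                                  ≡⟨ map-vertexAt-number (Supported⇒numbered p-supp _) ⟨
    Maybe.map vertexAt (p (vertexAt k) >>= number)  ≡⟨ cong (Maybe.map vertexAt) digit ⟩
    Maybe.map vertexAt (q (vertexAt k) >>= number)  ≡⟨ map-vertexAt-number (Supported⇒numbered q-supp _) ⟩
    q (vertexAt k)                                  ∎)
    where
    open ≡-Reasoning
    digit : (p (vertexAt k) >>= number) ≡ (q (vertexAt k) >>= number)
    digit = maybe-suc-zero-injective (begin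
      maybe suc zero (p (vertexAt k) >>= number)  ≡⟨ finToFun-funToFin _ k ⟨
      finToFun (encode p) k                       ≡⟨ cong (λ c → finToFun c k) eq ⟩
      finToFun (encode q) k                       ≡⟨ finToFun-funToFin _ k ⟩
      maybe suc zero (q (vertexAt k) >>= number)  ∎)

rank : ∀ {n} (S : Subset n) → Fin n → Maybe (Fin ∣ S ∣)
rank (inside  ∷ S) zero    = just zero
rank (outside ∷ S) zero    = nothing
rank (inside  ∷ S) (suc v) = Maybe.map suc (rank S v)
rank (outside ∷ S) (suc v) = rank S v

select : ∀ {n} (S : Subset n) → Fin ∣ S ∣ → Fin n
select (inside  ∷ S) zero    = zero
select (inside  ∷ S) (suc r) = suc (select S r)
select (outside ∷ S) r       = suc (select S r)

select-rank : ∀ {n} (S : Subset n) {v r} → rank S v ≡ just r → select S r ≡ v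
select-rank (inside  ∷ S) {zero}  refl = refl
select-rank (inside  ∷ S) {suc v} eq with rank S v in v↦r
... | just _ with refl ← eq = cong suc (select-rank S v↦r)
select-rank (outside ∷ S) {suc v} eq = cong suc (select-rank S eq)

rank-∈ : ∀ {n} {S : Subset n} {v} → v ∈ S → ∃ λ r → rank S v ≡ just r
rank-∈ {S = inside  ∷ S} here        = zero , refl
rank-∈ {S = inside  ∷ S} (there v∈S) = let r , eq = rank-∈ v∈S in suc r , cong (Maybe.map suc) eq
rank-∈ {S = outside ∷ S} (there v∈S) = rank-∈ v∈S

injective⇒≤∣p∣ : ∀ {m n} {S : Subset n} {f : Fin m → Fin n} →
                 (∀ i → f i ∈ S) → Injective _≡_ _≡_ f → m ≤ ∣ S ∣
injective⇒≤∣p∣ {S = S} {f} f∈S f-inj = injective⇒≤ {f = proj₁ ∘ rank-∈ ∘ f∈S} λ {i} {j} eq →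
  f-inj (begin
    f i                                ≡⟨ select-rank S (proj₂ (rank-∈ (f∈S i))) ⟨
    select S (proj₁ (rank-∈ (f∈S i)))  ≡⟨ cong (select S) eq ⟩
    select S (proj₁ (rank-∈ (f∈S j)))  ≡⟨ select-rank S (proj₂ (rank-∈ (f∈S j))) ⟩
    f j                                ∎)
  where open ≡-Reasoning

module Numbering {n} (S : Subset n) (m : ℕ) where

  number : Fin (n + m) → Maybe (Fin (∣ S ∣ + m))
  number x = [ (λ v → Maybe.map (_↑ˡ m) (rank S v)) , (λ j → just (∣ S ∣ ↑ʳ j)) ]′ (splitAt n x)

  vertexAt : Fin (∣ S ∣ + m) → Fin (n + m)
  vertexAt k = join n m (map₁ (select S) (splitAt ∣ S ∣ k))

  vertexAt-number : ∀ {x k} → number x ≡ just k → vertexAt k ≡ x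
  vertexAt-number {x} eq with splitAt n x in x≡
  ... | inj₂ j with refl ← eq =
    ≡.trans (cong (join n m ∘ map₁ (select S)) (splitAt-↑ʳ ∣ S ∣ m j)) (splitAt⁻¹-↑ʳ x≡)
  ... | inj₁ v with rank S v in v↦r
  ...   | just r with refl ← eq =
    ≡.trans (cong (join n m ∘ map₁ (select S)) (splitAt-↑ˡ ∣ S ∣ r m))
            (≡.trans (cong (_↑ˡ m) (select-rank S v↦r)) (splitAt⁻¹-↑ˡ x≡))

  InTree⇒numbered : ∀ {x} → InTree S m x → number x ≢ nothing
  InTree⇒numbered (inj₁ (v , refl , v∈S)) rewrite splitAt-↑ˡ n v m | proj₂ (rank-∈ v∈S) = λ ()
  InTree⇒numbered (inj₂ (j , refl))       rewrite splitAt-↑ʳ n m j = λ ()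

  InTree-↑ˡ : ∀ {v} → InTree S m (v ↑ˡ m) → v ∈ S
  InTree-↑ˡ {v} (inj₁ (w , eq , w∈S)) = subst (_∈ S) (≡.sym (↑ˡ-injective m v w eq)) w∈S
  InTree-↑ˡ {v} (inj₂ (j , eq))
    with () ← ≡.trans (≡.sym (splitAt-↑ˡ n v m)) (≡.trans (cong (splitAt n) eq) (splitAt-↑ʳ n m j))

module SystemParent {n} (G : SimpleGraph n) (S : Subset n) (m : ℕ) (A : Matrix (n + m))
                    (P : IsConnectingSystem G S m A) where
  open Numbering S m

  private
    tree = proj₁ P

    Adj-sym : ∀ i j → Adj A i j → Adj A j i
    Adj-sym = proj₁ tree

    Adj-InTree : ∀ i j → Adj A i j → InTree S m i
    Adj-InTree = proj₁ (proj₂ (proj₂ tree))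

    auxiliary-degree≥2 = proj₁ (proj₂ (proj₂ P))

  forest : IsForest (Adj A)
  forest = record
    { decidable   = λ i j → lookup (lookup A i) j ≟ᵇ true
    ; symmetric   = Adj-sym _ _
    ; irreflexive = proj₁ (proj₂ tree) _
    ; acyclic     = proj₂ (proj₂ (proj₂ (proj₂ tree)))
    }

  parent : Fin (n + m) → Maybe (Fin (n + m))
  parent = proj₁ (parentMap forest)

  parent-isParentMap : IsParentMap (Adj A) parent
  parent-isParentMap = proj₂ (parentMap forest)

  parent-InTree : ∀ {x y} → parent x ≡ just y → InTree S m x × InTree S m y
  parent-InTree {x} {y} eq = Adj-InTree x y Axy , Adj-InTree y x (Adj-sym x y Axy)
    where
    Axy = Equivalence.from (parent-isParentMap x y) (inj₁ eq)

  parent-supported : ParentMapCode.Supported number vertexAt vertexAt-number parent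
  parent-supported eq = let x∈ , y∈ = parent-InTree eq in InTree⇒numbered x∈ , InTree⇒numbered y∈

  child : ∀ i → Σ (Fin n) λ t → parent (t ↑ˡ m) ≡ just (n ↑ʳ i)
  child i with auxiliary-degree≥2 i
  ... | s , s′ , s≢s′ , As , As′
    with two-neighbours⇒child parent-isParentMap As As′ (s≢s′ ∘ ↑ˡ-injective m s s′)
  ...   | inj₁ eq = s , eq
  ...   | inj₂ eq = s′ , eq

  m≤∣S∣ : m ≤ ∣ S ∣
  m≤∣S∣ = injective⇒≤∣p∣ (λ i → InTree-↑ˡ (proj₁ (parent-InTree (proj₂ (child i))))) λ {i} {j} eq →
    ↑ʳ-injective n i j (just-injective (begin
      just (n ↑ʳ i)                  ≡⟨ proj₂ (child i) ⟨
      parent (proj₁ (child i) ↑ˡ m)  ≡⟨ cong (λ t → parent (t ↑ˡ m)) eq ⟩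
      parent (proj₁ (child j) ↑ˡ m)  ≡⟨ proj₂ (child j) ⟩
      just (n ↑ʳ j)                  ∎))
    where open ≡-Reasoning

≡true-⇔⇒≡ : ∀ {b b′ : Bool} → (b ≡ true ⇔ b′ ≡ true) → b ≡ b′
≡true-⇔⇒≡ {true}          b⇔b′ = ≡.sym (Equivalence.to b⇔b′ refl)
≡true-⇔⇒≡ {false} {false} _    = refl
≡true-⇔⇒≡ {false} {true}  b⇔b′ = Equivalence.from b⇔b′ refl

lookup-ext : ∀ {A : Set} {k} {xs ys : Vec A k} → (∀ i → lookup xs i ≡ lookup ys i) → xs ≡ ys
lookup-ext {xs = xs} {ys} eq =
  ≡.trans (≡.sym (tabulate∘lookup xs)) (≡.trans (tabulate-cong eq) (tabulate∘lookup ys))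

Adj-⇔⇒≡ : ∀ {k} {A A′ : Matrix k} → (∀ i j → Adj A i j ⇔ Adj A′ i j) → A ≡ A′
Adj-⇔⇒≡ Adj⇔ = lookup-ext λ i → lookup-ext λ j → ≡true-⇔⇒≡ (Adj⇔ i j)

1≤⌈log₂n⌉ : ∀ {n} → 2 ≤ n → 1 ≤ ⌈log₂ n ⌉
1≤⌈log₂n⌉ = ⌈log₂⌉-mono-≤

n≤2^⌈log₂n⌉ : ∀ n → n ≤ 2 ^ ⌈log₂ n ⌉
n≤2^⌈log₂n⌉ = <-rec _ bound
  where
  bound : ∀ n → (∀ {m} → m < n → m ≤ 2 ^ ⌈log₂ m ⌉) → n ≤ 2 ^ ⌈log₂ n ⌉
  bound 0                _   = z≤n
  bound 1                _   = ≤-refl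
  bound n@(suc (suc k)) rec = begin
    n                         ≡⟨ ⌊n/2⌋+⌈n/2⌉≡n n ⟨
    ⌊ n /2⌋ + ⌈ n /2⌉         ≤⟨ +-monoˡ-≤ ⌈ n /2⌉ (⌊n/2⌋≤⌈n/2⌉ n) ⟩
    ⌈ n /2⌉ + ⌈ n /2⌉         ≤⟨ +-mono-≤ half half ⟩
    2 ^ (ℓ ∸ 1) + 2 ^ (ℓ ∸ 1) ≡⟨ cong (2 ^ (ℓ ∸ 1) +_) (+-identityʳ (2 ^ (ℓ ∸ 1))) ⟨
    2 ^ (1 + (ℓ ∸ 1))         ≡⟨ cong (2 ^_) (m+[n∸m]≡n (1≤⌈log₂n⌉ {n} (s≤s (s≤s z≤n)))) ⟩
    2 ^ ℓ                     ∎
    where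
    open ≤-Reasoning
    ℓ = ⌈log₂ n ⌉
    half : ⌈ n /2⌉ ≤ 2 ^ (ℓ ∸ 1)
    half = subst (λ e → ⌈ n /2⌉ ≤ 2 ^ e) (⌈log₂⌈n/2⌉⌉≡⌈log₂n⌉∸1 n) (rec (⌈n/2⌉<n k))

slot-count-mono : ∀ {s m} → m ≤ s → suc (s + m) ^ (s + m) ≤ suc (s + s) ^ (s + s)
slot-count-mono {s} {m} m≤s = ≤-trans (^-monoˡ-≤ (s + m) (s≤s s+m≤s+s)) (^-monoʳ-≤ (suc (s + s)) s+m≤s+s)
  where
  s+m≤s+s = +-monoʳ-≤ s m≤s

code-count-bound : ∀ s ℓ → 1 ≤ s → 1 ≤ ℓ → s ≤ 2 ^ ℓ →
                   suc s * suc (s + s) ^ (s + s) ≤ 2 ^ (9 * s * ℓ)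
code-count-bound s@(suc t) ℓ@(suc l) _ _ s≤2^ℓ = begin
  suc s * B ^ (s + s)      ≤⟨ *-monoˡ-≤ (B ^ (s + s)) (s≤s (m≤m+n s s)) ⟩
  B ^ suc (s + s)          ≤⟨ ^-monoʳ-≤ B (subst (suc (s + s) ≤_) (≡.sym (3s≡ t)) (m≤m+n _ t)) ⟩
  B ^ (3 * s)              ≤⟨ ^-monoˡ-≤ (3 * s) B≤2^3ℓ ⟩
  (2 ^ (3 * ℓ)) ^ (3 * s)  ≡⟨ ^-*-assoc 2 (3 * ℓ) (3 * s) ⟩
  2 ^ (3 * ℓ * (3 * s))    ≡⟨ cong (2 ^_) (9sℓ≡ s ℓ) ⟩
  2 ^ (9 * s * ℓ)          ∎
  where
  open ≤-Reasoning
  B = suc (s + s)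
  3s≡ : ∀ t → 3 * suc t ≡ suc (suc t + suc t) + t
  3s≡ = solve-∀
  4s≡ : ∀ t → 4 * suc t ≡ suc (suc t + suc t) + suc (t + t)
  4s≡ = solve-∀
  3ℓ≡ : ∀ l → 3 * suc l ≡ 2 + suc l + (l + l)
  3ℓ≡ = solve-∀
  9sℓ≡ : ∀ s ℓ → 3 * ℓ * (3 * s) ≡ 9 * s * ℓ
  9sℓ≡ = solve-∀
  B≤2^3ℓ : B ≤ 2 ^ (3 * ℓ)
  B≤2^3ℓ = begin
    B            ≤⟨ subst (B ≤_) (≡.sym (4s≡ t)) (m≤m+n B _) ⟩
    4 * s        ≤⟨ *-monoʳ-≤ 4 s≤2^ℓ ⟩
    4 * 2 ^ ℓ    ≡⟨ *-assoc 2 2 (2 ^ ℓ) ⟩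
    2 ^ (2 + ℓ)  ≤⟨ ^-monoʳ-≤ 2 (subst (2 + ℓ ≤_) (≡.sym (3ℓ≡ l)) (m≤m+n _ _)) ⟩
    2 ^ (3 * ℓ)  ∎

module _ {n} (G : SimpleGraph n) (S : Subset n) where
  open ParentMapCode using (encode; encode-injective)

  encodeSystem : ConnectingSystem G S → Fin (suc ∣ S ∣ * suc (∣ S ∣ + ∣ S ∣) ^ (∣ S ∣ + ∣ S ∣))
  encodeSystem ((m , A) , P) =
    combine (fromℕ< (s≤s m≤∣S∣))
            (inject≤ (encode number vertexAt vertexAt-number parent) (slot-count-mono m≤∣S∣))
    where
    open Numbering S m
    open SystemParent G S m A P

  encodeSystem-injective : ∀ x y → encodeSystem x ≡ encodeSystem y → proj₁ x ≡ proj₁ y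
  encodeSystem-injective ((m , A) , P) ((m′ , A′) , P′) eq with combine-injective _ _ _ _ eq
  ... | m≡m′ , parents≡ with fromℕ<-injective m m′ _ _ m≡m′
  ... | refl = cong (m ,_) (Adj-⇔⇒≡ (same-parentMap⇒⇔ X.parent-isParentMap Y.parent-isParentMap
        (encode-injective number vertexAt vertexAt-number X.parent-supported Y.parent-supported
          (inject≤-injective _ _ _ _ parents≡))))
    where
    open Numbering S m
    module X = SystemParent G S m A P
    module Y = SystemParent G S m A′ P′

lemma7 : ∃[ c ] ∃[ s₀ ] (∀ {n} (G : SimpleGraph n) (S : Subset n) → s₀ ≤ ∣ S ∣ →
           Σ (ConnectingSystem G S → Fin (2 ^ (c * ∣ S ∣ * ⌈log₂ ∣ S ∣ ⌉))) λ f →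
             ∀ x y → f x ≡ f y → proj₁ x ≡ proj₁ y)
lemma7 = 9 , 2 , λ G S 2≤∣S∣ →
  let s = ∣ S ∣
      bound = code-count-bound s ⌈log₂ s ⌉
                (≤-trans (s≤s z≤n) 2≤∣S∣) (1≤⌈log₂n⌉ 2≤∣S∣) (n≤2^⌈log₂n⌉ s)
  in (λ x → inject≤ (encodeSystem G S x) bound) ,
     λ x y eq → encodeSystem-injective G S x y (inject≤-injective _ _ _ _ eq)
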